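{- Let $S$ be a cap in $\Sigma=\mathrm{PG}(n,2)$, let $K_C$ be a hyperplane with $S\cap K_C=\{c_0\}$ (so $|C|=1$), and let $H_\infty\subset K_C$ be a subspace of codimension $2$ in $\Sigma$ with $S\cap H_\infty=\emptyset$. Let $K_A,K_B$ be the other two hyperplanes containing $H_\infty$, $H_A=K_A\setminus H_\infty$, $H_B=K_B\setminus H_\infty$, $A=S\cap H_A$, $B=S\cap H_B$, $B'=H_B\setminus B$. Suppose $B'=c_0+A$ and $|A|\neq 2^{n-2}$. If $A$ (or $B$) is not periodic, then $S$ is a complete cap.
   Context: Points of $\mathrm{PG}(n,2)$ are the nonzero vectors of $\mathbb{F}_2^{n+1}$; three distinct points $x,y,z$ are collinear iff $x+y=z$. A cap is a set of points with no three collinear; it is complete if not properly contained in another cap. $z+X=\{z+x:x\in X\}$. A set $X$ is periodic if some point $v$ satisfies $v+X=X$. -}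

module Defs where

open import Data.Bool using (Bool; true; false; _∧_; _xor_; not)
open import Data.Nat using (ℕ; zero; suc; _+_)
open import Data.Vec using (Vec; []; _∷_; zipWith; replicate; foldr)
open import Data.List using (List; []; _∷_; map; _++_)
open import Data.Product using (Σ; _×_; _,_)
open import Data.Sum using (_⊎_)
open import Relation.Binary.PropositionalEquality using (_≡_; _≢_)
open import Relation.Nullary using (¬_)

-- Vectors of F_2^{n+1}, with F_2 = Bool (xor = addition, ∧ = multiplication).
V : ℕ → Set
V n = Vec Bool (suc n)

zeroV : ∀ {n} → V n
zeroV = replicate _ false

_⊕_ : ∀ {n} → V n → V n → V n
_⊕_ = zipWith _xor_

-- standard bilinear form; a linear functional is x ↦ a · x
_·_ : ∀ {m} → Vec Bool m → Vec Bool m → Bool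
a · x = foldr _ _xor_ false (zipWith _∧_ a x)

-- A set of points of PG(n,2), given by its characteristic function on F_2^{n+1};
-- it must not contain the zero vector (points are nonzero vectors).
PSet : ℕ → Set
PSet n = V n → Bool

_∈_ : ∀ {n} → V n → PSet n → Set
x ∈ X = X x ≡ true

_⊆_ : ∀ {n} → PSet n → PSet n → Set
X ⊆ Y = ∀ x → x ∈ X → x ∈ Y

IsPointSet : ∀ {n} → PSet n → Set
IsPointSet X = X zeroV ≡ false

-- cap: a set of points with no three (distinct) collinear; x,y,z collinear iff x + y = z
IsCap : ∀ {n} → PSet n → Set
IsCap S = IsPointSet S ×
  (∀ x y z → x ∈ S → y ∈ S → z ∈ S → x ≢ y → y ≢ z → x ≢ z → x ⊕ y ≢ z)

IsCompleteCap : ∀ {n} → PSet n → Set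
IsCompleteCap S = IsCap S × (∀ T → IsCap T → S ⊆ T → T ⊆ S)

-- X periodic: some point v with v + X = X
-- (y ∈ v + X  iff  v + y ∈ X, since v + v = 0)
Periodic : ∀ {n} → PSet n → Set
Periodic {n} X = Σ (V n) λ v → v ≢ zeroV × (∀ y → X (v ⊕ y) ≡ X y)

allVecs : (m : ℕ) → List (Vec Bool m)
allVecs zero = [] ∷ []
allVecs (suc m) = map (true ∷_) (allVecs m) ++ map (false ∷_) (allVecs m)

countL : ∀ {m} → (Vec Bool m → Bool) → List (Vec Bool m) → ℕ
countL P [] = 0
countL P (x ∷ xs) with P x
... | true = suc (countL P xs)
... | false = countL P xs

card : ∀ {n} → PSet n → ℕ
card {n} X = countL X (allVecs (suc n))

-- It suffices that every point p ∉ S lies on a secant of S; suppose p does not,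
-- and look at the coset of H∞ containing p.  If p ∈ H_A, then c₀ + p ∈ H_B is
-- not in B' = c₀ + A, hence lies in S, and {c₀, c₀ + p} is a secant through p.
-- If p ∈ H_B, then p ∈ B' gives c₀ + p ∈ A and the same secant.  If p ∈ K_C ∖ H∞,
-- then c₀ + p ∈ H∞ is a nonzero period of both A and B: a point x of A or B
-- whose translate falls out would produce the secant {x, x + p}.  If p ∈ H∞,
-- translation by p pairs off the points of H_A, and each pair holds exactly one
-- point of A (two would form a secant through p; none would put both of their
-- c₀-translates in S, again a secant through p), so |A| = |H_A| / 2 = 2^(n-2).
module Submission where

open import Defs
open import Data.Bool using (Bool; true; false; _∧_; not)
open import Data.Nat using (ℕ; _*_; _^_)
open import Data.Product using (_×_)
open import Data.Sum using (_⊎_)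
open import Relation.Binary.PropositionalEquality using (_≡_; _≢_)
open import Relation.Nullary using (¬_)
open import Data.Empty using (⊥)

open import Algebra.Bundles using (CommutativeRing)
open import Data.Bool using (_xor_)
open import Data.Bool.Properties using (∧-comm; ∧-zeroʳ; ∧-identityʳ; ∧-distribˡ-xor; xor-assoc; xor-comm; xor-same; xor-identityˡ; xor-identityʳ; xor-∧-commutativeRing; not-involutive)
open import Data.Empty using (⊥-elim)
open import Data.List using ([]; _∷_; map; _++_)
open import Data.Nat using (suc; _+_)
open import Data.Nat.Properties using (+-comm; +-suc; +-identityʳ; *-cancelˡ-≡)
open import Data.Nat.Solver using (module +-*-Solver)
open import Data.Product using (∃-syntax; _,_; proj₁)
open import Data.Sum using ([_,_]′)
open import Data.Vec using (Vec; []; _∷_; zipWith; replicate)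
open import Data.Vec.Properties using (zipWith-assoc; zipWith-comm; zipWith-identityˡ; zipWith-identityʳ)
open import Function using (_∘_)
open import Relation.Binary.PropositionalEquality using (refl; sym; trans; cong; cong₂; _≗_; ≢-sym; module ≡-Reasoning)
open import Algebra.Properties.CommutativeSemigroup (CommutativeRing.+-commutativeSemigroup xor-∧-commutativeRing) using () renaming (interchange to xor-interchange)

open ≡-Reasoning

true≢false : true ≢ false
true≢false ()

∧-true : ∀ {u v} → u ∧ v ≡ true → u ≡ true × v ≡ true
∧-true {true}  {true}  _ = refl , refl
∧-true {true}  {false} ()
∧-true {false}         ()

not∧-true : ∀ {u v} → not u ∧ v ≡ true → u ≡ false × v ≡ true
not∧-true {false} {true}  _ = refl , refl
not∧-true {false} {false} ()
not∧-true {true}          ()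

-- _⊕_ on V n is _⊞_ at length suc n, so the lemmas below apply to it.
_⊞_ : ∀ {m} → Vec Bool m → Vec Bool m → Vec Bool m
_⊞_ = zipWith _xor_

⊞-comm : ∀ {m} (x y : Vec Bool m) → x ⊞ y ≡ y ⊞ x
⊞-comm = zipWith-comm xor-comm

⊞-assoc : ∀ {m} (x y z : Vec Bool m) → (x ⊞ y) ⊞ z ≡ x ⊞ (y ⊞ z)
⊞-assoc = zipWith-assoc xor-assoc

⊞-identityˡ : ∀ {m} (x : Vec Bool m) → replicate m false ⊞ x ≡ x
⊞-identityˡ = zipWith-identityˡ xor-identityˡ

⊞-identityʳ : ∀ {m} (x : Vec Bool m) → x ⊞ replicate m false ≡ x
⊞-identityʳ = zipWith-identityʳ xor-identityʳ

⊞-self : ∀ {m} (x : Vec Bool m) → x ⊞ x ≡ replicate m false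
⊞-self []       = refl
⊞-self (x ∷ xs) = cong₂ _∷_ (xor-same x) (⊞-self xs)

⊞-cancelˡ : ∀ {m} (x y : Vec Bool m) → x ⊞ (x ⊞ y) ≡ y
⊞-cancelˡ x y = begin
  x ⊞ (x ⊞ y)                ≡⟨ sym (⊞-assoc x x y) ⟩
  (x ⊞ x) ⊞ y                ≡⟨ cong (_⊞ y) (⊞-self x) ⟩
  replicate _ false ⊞ y      ≡⟨ ⊞-identityˡ y ⟩
  y                          ∎

⊞-cancelʳ : ∀ {m} (x y : Vec Bool m) → (x ⊞ y) ⊞ y ≡ x
⊞-cancelʳ x y = begin
  (x ⊞ y) ⊞ y                ≡⟨ ⊞-assoc x y y ⟩
  x ⊞ (y ⊞ y)                ≡⟨ cong (x ⊞_) (⊞-self y) ⟩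
  x ⊞ replicate _ false      ≡⟨ ⊞-identityʳ x ⟩
  x                          ∎

⊞-leftComm : ∀ {m} (x y z : Vec Bool m) → x ⊞ (y ⊞ z) ≡ y ⊞ (x ⊞ z)
⊞-leftComm x y z = begin
  x ⊞ (y ⊞ z)                ≡⟨ sym (⊞-assoc x y z) ⟩
  (x ⊞ y) ⊞ z                ≡⟨ cong (_⊞ z) (⊞-comm x y) ⟩
  (y ⊞ x) ⊞ z                ≡⟨ ⊞-assoc y x z ⟩
  y ⊞ (x ⊞ z)                ∎

x⊞y≡0⇒x≡y : ∀ {m} (x y : Vec Bool m) → x ⊞ y ≡ replicate m false → x ≡ y
x⊞y≡0⇒x≡y x y x⊞y≡0 = begin
  x                          ≡⟨ sym (⊞-cancelʳ x y) ⟩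
  (x ⊞ y) ⊞ y                ≡⟨ cong (_⊞ y) x⊞y≡0 ⟩
  replicate _ false ⊞ y      ≡⟨ ⊞-identityˡ y ⟩
  y                          ∎

x⊞y≡y⇒x≡0 : ∀ {m} (x y : Vec Bool m) → x ⊞ y ≡ y → x ≡ replicate m false
x⊞y≡y⇒x≡0 x y x⊞y≡y = begin
  x                          ≡⟨ sym (⊞-cancelʳ x y) ⟩
  (x ⊞ y) ⊞ y                ≡⟨ cong (_⊞ y) x⊞y≡y ⟩
  y ⊞ y                      ≡⟨ ⊞-self y ⟩
  replicate _ false          ∎

·-comm : ∀ {m} (f x : Vec Bool m) → f · x ≡ x · f
·-comm []       []       = refl
·-comm (f ∷ fs) (x ∷ xs) = cong₂ _xor_ (∧-comm f x) (·-comm fs xs)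

·-zeroʳ : ∀ {m} (f : Vec Bool m) → f · replicate m false ≡ false
·-zeroʳ []       = refl
·-zeroʳ (f ∷ fs) = cong₂ _xor_ (∧-zeroʳ f) (·-zeroʳ fs)

·-distribˡ-⊞ : ∀ {m} (f x y : Vec Bool m) → f · (x ⊞ y) ≡ (f · x) xor (f · y)
·-distribˡ-⊞ []       []       []       = refl
·-distribˡ-⊞ (f ∷ fs) (x ∷ xs) (y ∷ ys) = begin
  (f ∧ (x xor y)) xor (fs · (xs ⊞ ys))
    ≡⟨ cong₂ _xor_ (∧-distribˡ-xor f x y) (·-distribˡ-⊞ fs xs ys) ⟩
  ((f ∧ x) xor (f ∧ y)) xor ((fs · xs) xor (fs · ys))
    ≡⟨ xor-interchange (f ∧ x) (f ∧ y) (fs · xs) (fs · ys) ⟩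
  ((f ∧ x) xor (fs · xs)) xor ((f ∧ y) xor (fs · ys))
    ∎

·-distribʳ-⊞ : ∀ {m} (f g x : Vec Bool m) → (f ⊞ g) · x ≡ (f · x) xor (g · x)
·-distribʳ-⊞ f g x = begin
  (f ⊞ g) · x                ≡⟨ ·-comm (f ⊞ g) x ⟩
  x · (f ⊞ g)                ≡⟨ ·-distribˡ-⊞ x f g ⟩
  (x · f) xor (x · g)        ≡⟨ cong₂ _xor_ (·-comm x f) (·-comm x g) ⟩
  (f · x) xor (g · x)        ∎

·-⊞ : ∀ {m} (f u x : Vec Bool m) {α β} → f · u ≡ α → f · x ≡ β → f · (u ⊞ x) ≡ α xor β
·-⊞ f u x refl refl = ·-distribˡ-⊞ f u x

separated : ∀ {m} (f : Vec Bool m) {x y} → f · x ≡ false → f · y ≡ true → x ≢ y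
separated f f·x f·y refl = true≢false (trans (sym f·y) f·x)

≢0⇒∃·≡true : ∀ {m} (f : Vec Bool m) → f ≢ replicate m false → ∃[ t ] f · t ≡ true
≢0⇒∃·≡true []          f≢0 = ⊥-elim (f≢0 refl)
≢0⇒∃·≡true (true ∷ f)  _   = true ∷ replicate _ false , cong not (·-zeroʳ f)
≢0⇒∃·≡true (false ∷ f) f≢0 =
  let t , f·t = ≢0⇒∃·≡true f (f≢0 ∘ cong (false ∷_)) in false ∷ t , f·t

separating-vector : ∀ {m} (f g : Vec Bool m) → f ≢ replicate m false → f ≢ g →
                    ∃[ t ] f · t ≡ true × g · t ≡ false
separating-vector f g f≢0 f≢g
  with ≢0⇒∃·≡true f f≢0 | ≢0⇒∃·≡true (f ⊞ g) (f≢g ∘ x⊞y≡0⇒x≡y f g)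
... | u , f·u | w , [f⊞g]·w
  with g · u in g·u | f · w in f·w | g · w in g·w | trans (sym (·-distribʳ-⊞ f g w)) [f⊞g]·w
... | false | _     | _     | _  = u , f·u , g·u
... | true  | true  | false | _  = w , f·w , g·w
... | true  | false | true  | _  = u ⊞ w , ·-⊞ f u w f·u f·w , ·-⊞ g u w g·u g·w
... | true  | true  | true  | ()
... | true  | false | false | ()

count : (m : ℕ) → (Vec Bool m → Bool) → ℕ
count m P = countL P (allVecs m)

countL-cong : ∀ {m} {P Q : Vec Bool m → Bool} → P ≗ Q → ∀ xs → countL P xs ≡ countL Q xs
countL-cong P≗Q []                  = refl
countL-cong {P = P} {Q} P≗Q (x ∷ xs) with P x | Q x | P≗Q x
... | true  | true  | _ = cong suc (countL-cong P≗Q xs)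
... | false | false | _ = countL-cong P≗Q xs
... | true  | false | ()
... | false | true  | ()

countL-split : ∀ {m} (P Q : Vec Bool m → Bool) xs →
  countL P xs ≡ countL (λ x → P x ∧ Q x) xs + countL (λ x → P x ∧ not (Q x)) xs
countL-split P Q []       = refl
countL-split P Q (x ∷ xs) with P x | Q x
... | true  | true  = cong suc (countL-split P Q xs)
... | true  | false = trans (cong suc (countL-split P Q xs)) (sym (+-suc _ _))
... | false | _     = countL-split P Q xs

countL-++ : ∀ {m} (P : Vec Bool m → Bool) xs ys → countL P (xs ++ ys) ≡ countL P xs + countL P ys
countL-++ P []       ys = refl
countL-++ P (x ∷ xs) ys with P x
... | true  = cong suc (countL-++ P xs ys)
... | false = countL-++ P xs ys

countL-map : ∀ {k m} (P : Vec Bool m → Bool) (g : Vec Bool k → Vec Bool m) xs →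
             countL P (map g xs) ≡ countL (P ∘ g) xs
countL-map P g []       = refl
countL-map P g (x ∷ xs) with P (g x)
... | true  = cong suc (countL-map P g xs)
... | false = countL-map P g xs

count-suc : ∀ m (P : Vec Bool (suc m) → Bool) →
            count (suc m) P ≡ count m (P ∘ (true ∷_)) + count m (P ∘ (false ∷_))
count-suc m P = trans (countL-++ P (map (true ∷_) (allVecs m)) _)
                      (cong₂ _+_ (countL-map P (true ∷_) (allVecs m)) (countL-map P (false ∷_) (allVecs m)))

count-all : ∀ m → count m (λ _ → true) ≡ 2 ^ m
count-all 0       = refl
count-all (suc m) = trans (count-suc m _)
  (cong₂ _+_ (count-all m) (trans (count-all m) (sym (+-identityʳ _))))

count-translate : ∀ {m} (u : Vec Bool m) (P : Vec Bool m → Bool) → count m (λ x → P (u ⊞ x)) ≡ count m P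
count-translate []                P = countL-cong {P = λ x → P ([] ⊞ x)} {Q = P} (λ { [] → refl }) (allVecs 0)
count-translate {suc m} (false ∷ u) P = begin
  count (suc m) (λ x → P ((false ∷ u) ⊞ x))
    ≡⟨ count-suc m _ ⟩
  count m (λ x → P (true ∷ (u ⊞ x))) + count m (λ x → P (false ∷ (u ⊞ x)))
    ≡⟨ cong₂ _+_ (count-translate u _) (count-translate u _) ⟩
  count m (P ∘ (true ∷_)) + count m (P ∘ (false ∷_))
    ≡⟨ sym (count-suc m P) ⟩
  count (suc m) P
    ∎
count-translate {suc m} (true ∷ u) P = begin
  count (suc m) (λ x → P ((true ∷ u) ⊞ x))
    ≡⟨ count-suc m _ ⟩
  count m (λ x → P (false ∷ (u ⊞ x))) + count m (λ x → P (true ∷ (u ⊞ x)))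
    ≡⟨ cong₂ _+_ (count-translate u _) (count-translate u _) ⟩
  count m (P ∘ (false ∷_)) + count m (P ∘ (true ∷_))
    ≡⟨ +-comm (count m (P ∘ (false ∷_))) _ ⟩
  count m (P ∘ (true ∷_)) + count m (P ∘ (false ∷_))
    ≡⟨ sym (count-suc m P) ⟩
  count (suc m) P
    ∎

count-halves : ∀ {m} (P : Vec Bool m → Bool) (f t : Vec Bool m) → f · t ≡ true → (∀ x → P (t ⊞ x) ≡ P x) →
               count m (λ x → P x ∧ f · x) ≡ count m (λ x → P x ∧ not (f · x))
count-halves {m} P f t f·t P-periodic = begin
  count m (λ x → P x ∧ f · x)
    ≡⟨ sym (count-translate t _) ⟩
  count m (λ x → P (t ⊞ x) ∧ f · (t ⊞ x))
    ≡⟨ countL-cong translate (allVecs m) ⟩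
  count m (λ x → P x ∧ not (f · x))
    ∎
  where
  translate : ∀ x → P (t ⊞ x) ∧ f · (t ⊞ x) ≡ P x ∧ not (f · x)
  translate x = cong₂ _∧_ (P-periodic x) (·-⊞ f t x f·t refl)

-- {c · x = 1} is half of the space (translate by t₂), and a · x cuts it in half
-- (translate by t₁, which does not change c · x).
count-quarter : ∀ {m} (a c : Vec Bool m) → a ≢ replicate m false → c ≢ replicate m false → a ≢ c →
                4 * count m (λ x → not (a · x) ∧ c · x) ≡ 2 ^ m
count-quarter {m} a c a≢0 c≢0 a≢c
  with separating-vector a c a≢0 a≢c | ≢0⇒∃·≡true c c≢0
... | t₁ , a·t₁ , c·t₁ | t₂ , c·t₂ = begin
  4 * q                      ≡⟨ solve 1 (λ q → con 4 :* q := (q :+ q) :+ (q :+ q)) refl q ⟩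
  (q + q) + (q + q)          ≡⟨ cong (λ k → k + k) (sym K≡q+q) ⟩
  K + K                      ≡⟨ cong (K +_) (count-halves (λ _ → true) c t₂ c·t₂ (λ _ → refl)) ⟩
  K + count m (not ∘ (c ·_)) ≡⟨ sym (countL-split (λ _ → true) (c ·_) (allVecs m)) ⟩
  count m (λ _ → true)       ≡⟨ count-all m ⟩
  2 ^ m                      ∎
  where
  open +-*-Solver
  q r K : ℕ
  q = count m (λ x → not (a · x) ∧ c · x)
  r = count m (λ x → c · x ∧ not (a · x))
  K = count m (c ·_)
  c-periodic : ∀ x → c · (t₁ ⊞ x) ≡ c · x
  c-periodic x = ·-⊞ c t₁ x c·t₁ refl
  K≡q+q : K ≡ q + q
  K≡q+q = begin
    K                                      ≡⟨ countL-split (c ·_) (a ·_) (allVecs m) ⟩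
    count m (λ x → c · x ∧ a · x) + r      ≡⟨ cong (_+ r) (count-halves (c ·_) a t₁ a·t₁ c-periodic) ⟩
    r + r                                  ≡⟨ cong (λ k → k + k) (countL-cong (λ x → ∧-comm (c · x) _) (allVecs m)) ⟩
    q + q                                  ∎

periodic-if-closed : ∀ {n} (X : PSet n) (v : V n) → (∀ x → x ∈ X → (v ⊕ x) ∈ X) → ∀ y → X (v ⊕ y) ≡ X y
periodic-if-closed X v closed y with X y in e₁ | X (v ⊕ y) in e₂
... | true  | true  = refl
... | false | false = refl
... | true  | false = ⊥-elim (true≢false (trans (sym (closed y e₁)) e₂))
... | false | true  =
  ⊥-elim (true≢false (trans (sym (closed (v ⊕ y) e₂)) (trans (cong X (⊞-cancelˡ v y)) e₁)))

OffSecants : ∀ {n} → PSet n → V n → Set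
OffSecants S p = ∀ x y → x ∈ S → y ∈ S → x ≢ y → x ⊕ y ≢ p

cap-complete : ∀ {n} {S : PSet n} → IsCap S →
               (∀ p → p ≢ zeroV → S p ≡ false → ¬ OffSecants S p) → IsCompleteCap S
cap-complete {S = S} S-cap on-secant = S-cap , maximal
  where
  maximal : ∀ T → IsCap T → S ⊆ T → T ⊆ S
  maximal T (T-points , T-cap) S⊆T p p∈T with S p in p∉S
  ... | true  = refl
  ... | false = ⊥-elim (on-secant p p≢0 p∉S off)
    where
    p≢0 : p ≢ zeroV
    p≢0 p≡0 = true≢false (trans (sym p∈T) (trans (cong T p≡0) T-points))
    ≢p : ∀ {x} → x ∈ S → x ≢ p
    ≢p x∈S x≡p = true≢false (trans (sym x∈S) (trans (cong S x≡p) p∉S))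
    off : OffSecants S p
    off x y x∈S y∈S x≢y = T-cap x y p (S⊆T x x∈S) (S⊆T y y∈S) p∈T x≢y (≢p y∈S) (≢p x∈S)

module _ {n : ℕ} (S : PSet n) (a c c₀ : V n) where

  H_A : PSet n
  H_A x = not (a · x) ∧ c · x

  A : PSet n
  A x = S x ∧ H_A x

  B : PSet n
  B x = S x ∧ (a · x ∧ c · x)

  A-elim : ∀ {x} → x ∈ A → x ∈ S × a · x ≡ false × c · x ≡ true
  A-elim {x} x∈A = let x∈S , x∈H_A = ∧-true {S x} x∈A in x∈S , not∧-true x∈H_A

  B-elim : ∀ {x} → x ∈ B → x ∈ S × a · x ≡ true × c · x ≡ true
  B-elim {x} x∈B = let x∈S , x∈H_B = ∧-true {S x} x∈B in x∈S , ∧-true x∈H_B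

  B-intro : ∀ {x} → x ∈ S → a · x ≡ true → c · x ≡ true → x ∈ B
  B-intro x∈S a·x c·x rewrite x∈S | a·x | c·x = refl

  module _ (a≢0 : a ≢ zeroV) (c≢0 : c ≢ zeroV) (a≢c : a ≢ c)
           (c₀∈S : c₀ ∈ S) (c·c₀ : c · c₀ ≡ false)
           (S∩H∞≡∅ : ∀ x → x ∈ S → c · x ≡ false → a · x ≡ false → ⊥)
           (B'≡c₀+A : ∀ y → not (S y) ∧ (a · y ∧ c · y) ≡ A (c₀ ⊕ y))
           (4|A|≢2ⁿ : 4 * card A ≢ 2 ^ n)
           (aperiodic : ¬ Periodic A ⊎ ¬ Periodic B) where

    a·c₀ : a · c₀ ≡ true
    a·c₀ with a · c₀ in e
    ... | true  = refl
    ... | false = ⊥-elim (S∩H∞≡∅ c₀ c₀∈S c·c₀ e)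

    A-c₀-translate : ∀ y → a · y ≡ true → c · y ≡ true → A (c₀ ⊕ y) ≡ not (S y)
    A-c₀-translate y a·y c·y = begin
      A (c₀ ⊕ y)                   ≡⟨ sym (B'≡c₀+A y) ⟩
      not (S y) ∧ (a · y ∧ c · y)  ≡⟨ cong (not (S y) ∧_) (cong₂ _∧_ a·y c·y) ⟩
      not (S y) ∧ true             ≡⟨ ∧-identityʳ _ ⟩
      not (S y)                    ∎

    S-c₀-translate : ∀ x → a · x ≡ false → c · x ≡ true → S (c₀ ⊕ x) ≡ not (A x)
    S-c₀-translate x a·x c·x = begin
      S (c₀ ⊕ x)               ≡⟨ sym (not-involutive _) ⟩
      not (not (S (c₀ ⊕ x)))   ≡⟨ cong not (sym (A-c₀-translate (c₀ ⊕ x) a·[c₀⊕x] c·[c₀⊕x])) ⟩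
      not (A (c₀ ⊕ (c₀ ⊕ x)))  ≡⟨ cong (not ∘ A) (⊞-cancelˡ c₀ x) ⟩
      not (A x)                ∎
      where
      a·[c₀⊕x] : a · (c₀ ⊕ x) ≡ true
      a·[c₀⊕x] = ·-⊞ a c₀ x a·c₀ a·x
      c·[c₀⊕x] : c · (c₀ ⊕ x) ≡ true
      c·[c₀⊕x] = ·-⊞ c c₀ x c·c₀ c·x

    module _ {p : V n} (p∉S : S p ≡ false) (off : OffSecants S p) where

      p∉H_A : a · p ≡ false → c · p ≡ true → ⊥
      p∉H_A a·p c·p =
        off c₀ (c₀ ⊕ p) c₀∈S c₀⊕p∈S (separated c c·c₀ (·-⊞ c c₀ p c·c₀ c·p)) (⊞-cancelˡ c₀ p)
        where
        c₀⊕p∈S : (c₀ ⊕ p) ∈ S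
        c₀⊕p∈S = trans (S-c₀-translate p a·p c·p) (cong (λ s → not (s ∧ H_A p)) p∉S)

      p∉H_B : a · p ≡ true → c · p ≡ true → ⊥
      p∉H_B a·p c·p =
        let c₀⊕p∈S , _ , c·[c₀⊕p] = A-elim (trans (A-c₀-translate p a·p c·p) (cong not p∉S))
        in off c₀ (c₀ ⊕ p) c₀∈S c₀⊕p∈S (separated c c·c₀ c·[c₀⊕p]) (⊞-cancelˡ c₀ p)

      p∉K_C∖H∞ : a · p ≡ true → c · p ≡ false → ⊥
      p∉K_C∖H∞ a·p c·p =
        [ (λ ¬A-periodic → ¬A-periodic (h , h≢0 , periodic-if-closed A h A-closed))
        , (λ ¬B-periodic → ¬B-periodic (h , h≢0 , periodic-if-closed B h B-closed)) ]′ aperiodic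
        where
        h : V n
        h = c₀ ⊕ p

        h≢0 : h ≢ zeroV
        h≢0 h≡0 = true≢false (trans (sym c₀∈S) (trans (cong S (x⊞y≡0⇒x≡y c₀ p h≡0)) p∉S))

        A-closed : ∀ x → x ∈ A → (h ⊕ x) ∈ A
        A-closed x x∈A with A-elim x∈A | S (p ⊕ x) in p⊕x∈S
        ... | x∈S , a·x , _   | true  =
          ⊥-elim (off (p ⊕ x) x p⊕x∈S x∈S (≢-sym (separated a a·x a·[p⊕x])) (⊞-cancelʳ p x))
          where
          a·[p⊕x] : a · (p ⊕ x) ≡ true
          a·[p⊕x] = ·-⊞ a p x a·p a·x
        ... | _   , a·x , c·x | false = begin
          A (h ⊕ x)             ≡⟨ cong A (⊞-assoc c₀ p x) ⟩
          A (c₀ ⊕ (p ⊕ x))      ≡⟨ A-c₀-translate (p ⊕ x) (·-⊞ a p x a·p a·x) (·-⊞ c p x c·p c·x) ⟩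
          not (S (p ⊕ x))       ≡⟨ cong not p⊕x∈S ⟩
          true                  ∎

        B-closed : ∀ y → y ∈ B → (h ⊕ y) ∈ B
        B-closed y y∈B with B-elim y∈B | A (p ⊕ y) in p⊕y∈A
        ... | y∈S , a·y , _   | true  =
          let p⊕y∈S , a·[p⊕y] , _ = A-elim p⊕y∈A
          in ⊥-elim (off (p ⊕ y) y p⊕y∈S y∈S (separated a a·[p⊕y] a·y) (⊞-cancelʳ p y))
        ... | _   , a·y , c·y | false = begin
          B (h ⊕ y)
            ≡⟨ cong B (⊞-assoc c₀ p y) ⟩
          B (c₀ ⊕ (p ⊕ y))
            ≡⟨ B-intro c₀⊕p⊕y∈S (·-⊞ a c₀ (p ⊕ y) a·c₀ a·[p⊕y]) (·-⊞ c c₀ (p ⊕ y) c·c₀ c·[p⊕y]) ⟩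
          true
            ∎
          where
          a·[p⊕y] : a · (p ⊕ y) ≡ false
          a·[p⊕y] = ·-⊞ a p y a·p a·y
          c·[p⊕y] : c · (p ⊕ y) ≡ true
          c·[p⊕y] = ·-⊞ c p y c·p c·y
          c₀⊕p⊕y∈S : (c₀ ⊕ (p ⊕ y)) ∈ S
          c₀⊕p⊕y∈S = trans (S-c₀-translate (p ⊕ y) a·[p⊕y] c·[p⊕y]) (cong not p⊕y∈A)

      H∞-point⇒4|A|≡2ⁿ : p ≢ zeroV → a · p ≡ false → c · p ≡ false → 4 * card A ≡ 2 ^ n
      H∞-point⇒4|A|≡2ⁿ p≢0 a·p c·p = *-cancelˡ-≡ _ _ 2 (begin
        2 * (4 * card A)        ≡⟨ solve 1 (λ q → con 2 :* (con 4 :* q) := con 4 :* (q :+ q)) refl (card A) ⟩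
        4 * (card A + card A)   ≡⟨ cong (4 *_) (sym |H_A|≡2|A|) ⟩
        4 * card H_A            ≡⟨ count-quarter a c a≢0 c≢0 a≢c ⟩
        2 ^ suc n               ∎)
        where
        open +-*-Solver

        H_A-periodic : ∀ x → H_A (p ⊕ x) ≡ H_A x
        H_A-periodic x = cong₂ (λ u v → not u ∧ v) (·-⊞ a p x a·p refl) (·-⊞ c p x c·p refl)

        one-of-pair : ∀ x → x ∈ H_A → A (p ⊕ x) ≡ not (A x)
        one-of-pair x x∈H_A with not∧-true x∈H_A | A x in x∈A | A (p ⊕ x) in p⊕x∈A
        ... | _ | true  | false = refl
        ... | _ | false | true  = refl
        ... | _ | true  | true  =
          ⊥-elim (off (p ⊕ x) x (proj₁ (A-elim p⊕x∈A)) (proj₁ (A-elim x∈A)) p⊕x≢x (⊞-cancelʳ p x))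
          where
          p⊕x≢x : p ⊕ x ≢ x
          p⊕x≢x = p≢0 ∘ x⊞y≡y⇒x≡0 p x
        ... | a·x , c·x | false | false =
          ⊥-elim (off (p ⊕ (c₀ ⊕ x)) (c₀ ⊕ x) p⊕c₀⊕x∈S c₀⊕x∈S p⊕c₀⊕x≢c₀⊕x (⊞-cancelʳ p (c₀ ⊕ x)))
          where
          c₀⊕x∈S : (c₀ ⊕ x) ∈ S
          c₀⊕x∈S = trans (S-c₀-translate x a·x c·x) (cong not x∈A)
          p⊕c₀⊕x∈S : (p ⊕ (c₀ ⊕ x)) ∈ S
          p⊕c₀⊕x∈S = begin
            S (p ⊕ (c₀ ⊕ x))    ≡⟨ cong S (⊞-leftComm p c₀ x) ⟩
            S (c₀ ⊕ (p ⊕ x))    ≡⟨ S-c₀-translate (p ⊕ x) (·-⊞ a p x a·p a·x) (·-⊞ c p x c·p c·x) ⟩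
            not (A (p ⊕ x))     ≡⟨ cong not p⊕x∈A ⟩
            true                ∎
          p⊕c₀⊕x≢c₀⊕x : p ⊕ (c₀ ⊕ x) ≢ c₀ ⊕ x
          p⊕c₀⊕x≢c₀⊕x = p≢0 ∘ x⊞y≡y⇒x≡0 p (c₀ ⊕ x)

        pair-split : ∀ x → H_A x ∧ not (A x) ≡ A (p ⊕ x)
        pair-split x with H_A x | one-of-pair x | H_A-periodic x
        ... | true  | one-of | _         = sym (one-of refl)
        ... | false | _      | p⊕x∉H_A = sym (trans (cong (S (p ⊕ x) ∧_) p⊕x∉H_A) (∧-zeroʳ _))

        |H_A|≡2|A| : card H_A ≡ card A + card A
        |H_A|≡2|A| = begin
          card H_A
            ≡⟨ countL-split H_A A (allVecs (suc n)) ⟩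
          count (suc n) (λ x → H_A x ∧ A x) + count (suc n) (λ x → H_A x ∧ not (A x))
            ≡⟨ cong₂ _+_ (countL-cong H_A∧A≡A (allVecs (suc n))) (countL-cong pair-split (allVecs (suc n))) ⟩
          card A + count (suc n) (λ x → A (p ⊕ x))
            ≡⟨ cong (card A +_) (count-translate p A) ⟩
          card A + card A
            ∎
          where
          H_A∧A≡A : ∀ x → H_A x ∧ A x ≡ A x
          H_A∧A≡A x with H_A x
          ... | true  = refl
          ... | false = sym (∧-zeroʳ (S x))

    no-point-off-secants : ∀ p → p ≢ zeroV → S p ≡ false → ¬ OffSecants S p
    no-point-off-secants p p≢0 p∉S off with a · p in a·p | c · p in c·p
    ... | false | true  = p∉H_A p∉S off a·p c·p
    ... | true  | true  = p∉H_B p∉S off a·p c·p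
    ... | true  | false = p∉K_C∖H∞ p∉S off a·p c·p
    ... | false | false = 4|A|≢2ⁿ (H∞-point⇒4|A|≡2ⁿ p∉S off p≢0 a·p c·p)

theorem3p3 : (n : ℕ) (S : PSet n) (c a c₀ : V n) →
    IsCap S →
    c ≢ zeroV → a ≢ zeroV → a ≢ c →
    (∀ x → (x ∈ S × c · x ≡ false) → x ≡ c₀) → c₀ ∈ S → c · c₀ ≡ false →
    (∀ x → x ∈ S → c · x ≡ false → a · x ≡ false → ⊥) →
    let A : PSet n
        A = λ x → S x ∧ (not (a · x) ∧ c · x)
        B : PSet n
        B = λ x → S x ∧ (a · x ∧ c · x)
        B' : PSet n
        B' = λ x → not (S x) ∧ (a · x ∧ c · x)
    in (∀ y → B' y ≡ A (c₀ ⊕ y)) →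
       4 * card A ≢ 2 ^ n →
       (¬ Periodic A ⊎ ¬ Periodic B) →
       IsCompleteCap S
-- The argument only uses c₀ ∈ S ∩ K_C, not that c₀ is the only point of S in K_C.
theorem3p3 n S c a c₀ S-cap c≢0 a≢0 a≢c _ c₀∈S c·c₀ S∩H∞≡∅ B'≡c₀+A 4|A|≢2ⁿ aperiodic =
  cap-complete S-cap
    (no-point-off-secants S a c c₀ a≢0 c≢0 a≢c c₀∈S c·c₀ S∩H∞≡∅ B'≡c₀+A 4|A|≢2ⁿ aperiodic)
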